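{- Let $X,Y,Z,\varphi$ be independent indeterminates over $\mathbb{Q}$ and define $$W_2=(X+Y+Z)^2-12(XY+YZ+ZX),\qquad W_3=(X-Y)(Y-Z)(Z-X),\qquad \mathfrak{W}_3=XYZ-\varphi^3,$$ $$W_4=(X+Y+Z)\big[(X+Y+Z)^3+216XYZ\big],\qquad \mathfrak{W}_4=\varphi\big[27XYZ-(X+Y+Z)^3\big],$$ $$W_6=(X+Y+Z)^6-540XYZ(X+Y+Z)^3-5832X^2Y^2Z^2.$$ Then $$W_2^3-3W_2W_4+2W_6=432W_3^2,$$ and $U:=X+Y+Z$ satisfies $$27U^8-18W_4U^4-8W_6U^2-W_4^2=0\qquad\text{and}\qquad 8U^3\big(W_6^2-W_4^3-1728\mathfrak{W}_4^3\big)=27\,\mathfrak{W}_3\,(W_4-9U^4)^3.$$ -}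

module Defs where

open import Level using (Level)
open import Data.Nat using (ℕ; zero; suc)
open import Algebra.Bundles using (CommutativeRing)

-- The quantities of Theorem 3.17, computed in an arbitrary commutative ring R
-- from elements X Y Z φ.  (An identity with integer coefficients holds in
-- ℚ[X,Y,Z,φ] iff it holds for all elements of all commutative rings.)
module Quantities {c ℓ : Level} (R : CommutativeRing c ℓ) where
  open CommutativeRing R

  #_ : ℕ → Carrier
  # zero  = 0#
  # suc n = 1# + # n

  infixr 8 _^_
  _^_ : Carrier → ℕ → Carrier
  x ^ zero  = 1#
  x ^ suc n = x * (x ^ n)

  module _ (X Y Z φ : Carrier) where
    U : Carrier
    U = X + Y + Z

    W₂ : Carrier
    W₂ = U ^ 2 - # 12 * (X * Y + Y * Z + Z * X)

    W₃ : Carrier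
    W₃ = (X - Y) * (Y - Z) * (Z - X)

    𝔚₃ : Carrier
    𝔚₃ = X * Y * Z - φ ^ 3

    W₄ : Carrier
    W₄ = U * (U ^ 3 + # 216 * (X * Y * Z))

    𝔚₄ : Carrier
    𝔚₄ = φ * (# 27 * (X * Y * Z) - U ^ 3)

    W₆ : Carrier
    W₆ = U ^ 6 - # 540 * (X * Y * Z) * U ^ 3 - # 5832 * (X ^ 2 * Y ^ 2 * Z ^ 2)

{-# OPTIONS --safe #-}
-- Each of the three identities is a polynomial identity with integer
-- coefficients in X, Y, Z, φ, so it holds in every commutative ring as soon
-- as its two sides have the same normal form in ℤ[X,Y,Z,φ]; that normal form
-- is transported to R along the canonical ring homomorphism ℤ → R.
module Submission where

open import Defs
open import Level using (Level)
open import Data.Product using (_×_; _,_)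
open import Algebra.Bundles using (Ring; CommutativeRing)
open import Data.Nat as ℕ using (ℕ; zero; suc; _∸_; _≤_)
import Data.Nat.Properties as ℕ
open import Data.Integer as ℤ using (ℤ; +_; -[1+_]; _⊖_)
import Data.Integer.Properties as ℤ
open import Data.Maybe using (map)
open import Data.Sum using (inj₁; inj₂)
open import Data.Vec using (Vec; _∷_; [])
open import Data.Fin using (Fin)
open import Function using (_∘_)
open import Relation.Binary.Definitions using (WeaklyDecidable)
open import Relation.Binary.Consequences using (dec⇒weaklyDec)
import Relation.Binary.PropositionalEquality as ≡
open import Algebra.Solver.Ring.AlmostCommutativeRing
  using (fromCommutativeRing; _-Raw-AlmostCommutative⟶_; Induced-equivalence)

module IntegerCast {c ℓ} (R : Ring c ℓ) where
  open Ring R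
  open import Algebra.Properties.Ring R
  open import Algebra.Properties.Semiring.Mult semiring
    using (×-homo-+; ×1-homo-*) renaming (_×_ to _×ᴿ_)
  open import Relation.Binary.Reasoning.Setoid setoid

  fromℕ : ℕ → Carrier
  fromℕ n = n ×ᴿ 1#

  fromℤ : ℤ → Carrier
  fromℤ (+ n)    = fromℕ n
  fromℤ -[1+ n ] = - fromℕ (suc n)

  fromℕ-homo-∸ : ∀ {m n} → n ≤ m → fromℕ (m ∸ n) ≈ fromℕ m - fromℕ n
  fromℕ-homo-∸ {m} {n} n≤m = begin
    fromℕ (m ∸ n)                      ≈⟨ xyx⁻¹≈y (fromℕ n) (fromℕ (m ∸ n)) ⟨
    fromℕ n + fromℕ (m ∸ n) - fromℕ n  ≈⟨ +-congʳ (×-homo-+ 1# n (m ∸ n)) ⟨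
    fromℕ (n ℕ.+ (m ∸ n)) - fromℕ n    ≡⟨ ≡.cong (λ k → fromℕ k - fromℕ n) (ℕ.m+[n∸m]≡n n≤m) ⟩
    fromℕ m - fromℕ n                  ∎

  fromℤ-homo-neg : ∀ i → fromℤ (ℤ.- i) ≈ - fromℤ i
  fromℤ-homo-neg (+ zero)  = sym -0#≈0#
  fromℤ-homo-neg (+ suc n) = refl
  fromℤ-homo-neg -[1+ n ]  = sym (-‿involutive _)

  fromℤ-homo-⊖ : ∀ m n → fromℤ (m ⊖ n) ≈ fromℕ m - fromℕ n
  fromℤ-homo-⊖ m n with ℕ.≤-total n m
  ... | inj₁ n≤m = begin
    fromℤ (m ⊖ n)      ≡⟨ ≡.cong fromℤ (ℤ.⊖-≥ n≤m) ⟩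
    fromℕ (m ∸ n)      ≈⟨ fromℕ-homo-∸ n≤m ⟩
    fromℕ m - fromℕ n  ∎
  ... | inj₂ m≤n = begin
    fromℤ (m ⊖ n)          ≡⟨ ≡.cong fromℤ (ℤ.⊖-≤ m≤n) ⟩
    fromℤ (ℤ.- + (n ∸ m))  ≈⟨ fromℤ-homo-neg (+ (n ∸ m)) ⟩
    - fromℕ (n ∸ m)        ≈⟨ -‿cong (fromℕ-homo-∸ m≤n) ⟩
    - (fromℕ n - fromℕ m)  ≈⟨ ⁻¹-anti-homo‿- (fromℕ n) (fromℕ m) ⟩
    fromℕ m - fromℕ n      ∎

  fromℤ-homo-+ : ∀ i j → fromℤ (i ℤ.+ j) ≈ fromℤ i + fromℤ j
  fromℤ-homo-+ (+ m)    (+ n)    = ×-homo-+ 1# m n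
  fromℤ-homo-+ (+ m)    -[1+ n ] = fromℤ-homo-⊖ m (suc n)
  fromℤ-homo-+ -[1+ m ] (+ n)    = trans (fromℤ-homo-⊖ n (suc m)) (+-comm _ _)
  fromℤ-homo-+ -[1+ m ] -[1+ n ] = begin
    fromℤ (-[1+ m ] ℤ.+ -[1+ n ])      ≡⟨ ≡.cong fromℤ (ℤ.neg-distrib-+ (+ suc m) (+ suc n)) ⟨
    fromℤ (ℤ.- (+ suc m ℤ.+ + suc n))  ≈⟨ fromℤ-homo-neg (+ suc m ℤ.+ + suc n) ⟩
    - fromℕ (suc m ℕ.+ suc n)          ≈⟨ -‿cong (×-homo-+ 1# (suc m) (suc n)) ⟩
    - (fromℕ (suc m) + fromℕ (suc n))  ≈⟨ -‿+-comm _ _ ⟨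
    - fromℕ (suc m) + - fromℕ (suc n)  ∎

  fromℤ-homo-*-ℕ : ∀ m n → fromℤ (+ m ℤ.* + n) ≈ fromℕ m * fromℕ n
  fromℤ-homo-*-ℕ m n = begin
    fromℤ (+ m ℤ.* + n)  ≡⟨ ≡.cong fromℤ (ℤ.pos-* m n) ⟨
    fromℕ (m ℕ.* n)      ≈⟨ ×1-homo-* m n ⟩
    fromℕ m * fromℕ n    ∎

  fromℤ-homo-*-ℕˡ : ∀ m j → fromℤ (+ m ℤ.* j) ≈ fromℕ m * fromℤ j
  fromℤ-homo-*-ℕˡ m (+ n)    = fromℤ-homo-*-ℕ m n
  fromℤ-homo-*-ℕˡ m -[1+ n ] = begin
    fromℤ (+ m ℤ.* -[1+ n ])       ≡⟨ ≡.cong fromℤ (ℤ.neg-distribʳ-* (+ m) (+ suc n)) ⟨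
    fromℤ (ℤ.- (+ m ℤ.* + suc n))  ≈⟨ fromℤ-homo-neg (+ m ℤ.* + suc n) ⟩
    - fromℤ (+ m ℤ.* + suc n)      ≈⟨ -‿cong (fromℤ-homo-*-ℕ m (suc n)) ⟩
    - (fromℕ m * fromℕ (suc n))    ≈⟨ -‿distribʳ-* _ _ ⟩
    fromℕ m * - fromℕ (suc n)      ∎

  fromℤ-homo-* : ∀ i j → fromℤ (i ℤ.* j) ≈ fromℤ i * fromℤ j
  fromℤ-homo-* (+ m)    j = fromℤ-homo-*-ℕˡ m j
  fromℤ-homo-* -[1+ m ] j = begin
    fromℤ (-[1+ m ] ℤ.* j)       ≡⟨ ≡.cong fromℤ (ℤ.neg-distribˡ-* (+ suc m) j) ⟨
    fromℤ (ℤ.- (+ suc m ℤ.* j))  ≈⟨ fromℤ-homo-neg (+ suc m ℤ.* j) ⟩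
    - fromℤ (+ suc m ℤ.* j)      ≈⟨ -‿cong (fromℤ-homo-*-ℕˡ (suc m) j) ⟩
    - (fromℕ (suc m) * fromℤ j)  ≈⟨ -‿distribˡ-* _ _ ⟩
    - fromℕ (suc m) * fromℤ j    ∎

module IntegerCoefficients {c ℓ} (R : CommutativeRing c ℓ) where
  open CommutativeRing R using (ring; reflexive; refl; +-identityʳ; 1#)
  open IntegerCast ring

  fromℤ-morphism : ℤ.+-*-rawRing -Raw-AlmostCommutative⟶ fromCommutativeRing R
  fromℤ-morphism = record
    { ⟦_⟧    = fromℤ
    ; +-homo = fromℤ-homo-+
    ; *-homo = fromℤ-homo-*
    ; -‿homo = fromℤ-homo-neg
    ; 0-homo = refl
    ; 1-homo = +-identityʳ 1#
    }

  fromℤ-≈? : WeaklyDecidable (Induced-equivalence fromℤ-morphism)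
  fromℤ-≈? i j = map (reflexive ∘ ≡.cong fromℤ) (dec⇒weaklyDec ℤ._≟_ i j)

  open import Algebra.Solver.Ring ℤ.+-*-rawRing (fromCommutativeRing R) fromℤ-morphism fromℤ-≈? public

-- Their
-- denotations are definitionally those quantities, since for a numeral n both
-- fromℤ (+ n) and # n unfold to 1# + (1# + ⋯ + 0#).
module QuantityPolynomials {c ℓ} (R : CommutativeRing c ℓ) where
  open IntegerCoefficients R

  :#_ : ℕ → Polynomial 4
  :# n = con (+ n)

  x y z ϕ : Polynomial 4
  x = var Fin.zero
  y = var (Fin.suc Fin.zero)
  z = var (Fin.suc (Fin.suc Fin.zero))
  ϕ = var (Fin.suc (Fin.suc (Fin.suc Fin.zero)))

  u w₂ w₃ 𝔴₃ w₄ 𝔴₄ w₆ : Polynomial 4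
  u  = x :+ y :+ z
  w₂ = u :^ 2 :- :# 12 :* (x :* y :+ y :* z :+ z :* x)
  w₃ = (x :- y) :* (y :- z) :* (z :- x)
  𝔴₃ = x :* y :* z :- ϕ :^ 3
  w₄ = u :* (u :^ 3 :+ :# 216 :* (x :* y :* z))
  𝔴₄ = ϕ :* (:# 27 :* (x :* y :* z) :- u :^ 3)
  w₆ = u :^ 6 :- :# 540 :* (x :* y :* z) :* u :^ 3 :- :# 5832 :* (x :^ 2 :* y :^ 2 :* z :^ 2)

theorem3p17 : ∀ {c ℓ : Level} (R : CommutativeRing c ℓ) →
    let open CommutativeRing R in
    let open Quantities R in
    ∀ (X Y Z φ : Carrier) →
      ((W₂ X Y Z φ ^ 3 - # 3 * W₂ X Y Z φ * W₄ X Y Z φ + # 2 * W₆ X Y Z φ) ≈ # 432 * W₃ X Y Z φ ^ 2)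
      × ((# 27 * U X Y Z φ ^ 8 - # 18 * W₄ X Y Z φ * U X Y Z φ ^ 4 - # 8 * W₆ X Y Z φ * U X Y Z φ ^ 2 - W₄ X Y Z φ ^ 2) ≈ 0#)
      × ((# 8 * U X Y Z φ ^ 3 * (W₆ X Y Z φ ^ 2 - W₄ X Y Z φ ^ 3 - # 1728 * 𝔚₄ X Y Z φ ^ 3)) ≈ # 27 * 𝔚₃ X Y Z φ * (W₄ X Y Z φ - # 9 * U X Y Z φ ^ 4) ^ 3)
theorem3p17 R X Y Z φ =
    prove ρ (w₂ :^ 3 :- :# 3 :* w₂ :* w₄ :+ :# 2 :* w₆) (:# 432 :* w₃ :^ 2) refl
  , prove ρ (:# 27 :* u :^ 8 :- :# 18 :* w₄ :* u :^ 4 :- :# 8 :* w₆ :* u :^ 2 :- w₄ :^ 2) (:# 0) refl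
  , prove ρ (:# 8 :* u :^ 3 :* (w₆ :^ 2 :- w₄ :^ 3 :- :# 1728 :* 𝔴₄ :^ 3))
            (:# 27 :* 𝔴₃ :* (w₄ :- :# 9 :* u :^ 4) :^ 3) refl
  where
  open CommutativeRing R using (Carrier; refl)
  open IntegerCoefficients R
  open QuantityPolynomials R

  ρ : Vec Carrier 4
  ρ = X ∷ Y ∷ Z ∷ φ ∷ []
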